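{- Let $p\ge 2$ and let $T$ be a spider with $p$ legs, each of length at least $2$. Let $\beta(T)=\min\{\nu(T-e): e\in E(T)\}$. Then for every integer $n\ge |V(T)|$, $$ar(K_n,T)\ge(\beta(T)-1)n-\binom{\beta(T)}{2}+r,$$ where $r=2$ if exactly one leg of $T$ has even length and $r=1$ otherwise.
   Context: A spider with $p$ legs is a tree $T$ with a vertex $c$ (the center) such that $T$ is the union of $p$ paths (the legs), each having $c$ as an endpoint, which pairwise share only the vertex $c$; the length of a leg is its number of edges. $\nu(H)$ denotes the matching number of a graph $H$ (maximum number of pairwise disjoint edges), and $T-e$ is $T$ with the edge $e$ deleted. A subgraph of an edge-colored graph is rainbow if all its edges receive distinct colors. For a graph $G$, $ar(K_n,G)$ is the maximum number of colors in an edge-coloring of $K_n$ containing no rainbow copy of $G$. -}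

module Defs where

open import Data.Nat using (ℕ; zero; suc; _+_; _≤_)
open import Data.Nat.Combinatorics using (_C_)
open import Data.Fin using (Fin; zero; suc)
open import Data.Maybe using (Maybe; just; nothing)
open import Data.Product using (Σ; ∃; _×_; _,_; proj₁; proj₂)
open import Data.Bool using (Bool; true; false; if_then_else_)
open import Relation.Binary.PropositionalEquality using (_≡_; _≢_)
open import Data.Integer as ℤ using (ℤ; +_)

sumFin : ∀ {p} → (Fin p → ℕ) → ℕ
sumFin {zero}  f = 0
sumFin {suc p} f = f zero + sumFin (λ i → f (suc i))

-- predecessor position on a leg (nothing = the center)
prev : ∀ {m} → Fin m → Maybe (Fin m)
prev zero    = nothing
prev (suc j) = just (Data.Fin.inject₁ j)

evenb : ℕ → Bool
evenb zero = true
evenb (suc zero) = false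
evenb (suc (suc n)) = evenb n

-- Vertices: the center (nothing) and, for each leg i and j : Fin (ℓ i),
-- the vertex (i , j) at distance j+1 from the center on leg i.
-- Every non-center vertex v has a unique parent edge {v, parent v};
-- so edges are indexed by the non-center vertices.

module Spider {p : ℕ} (ℓ : Fin p → ℕ) where

  LegVertex : Set
  LegVertex = Σ (Fin p) (λ i → Fin (ℓ i))

  Vertex : Set
  Vertex = Maybe LegVertex

  Edge : Set
  Edge = LegVertex

  child : Edge → Vertex
  child e = just e

  parent : Edge → Vertex
  parent (i , j) = Data.Maybe.map (i ,_) (prev j)

  order : ℕ
  order = suc (sumFin ℓ)

  VertexDisjoint : Edge → Edge → Set
  VertexDisjoint e f =
    (child e ≢ child f) × (child e ≢ parent f) ×
    (parent e ≢ child f) × (parent e ≢ parent f)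

  MatchingIn : Edge → ℕ → Set
  MatchingIn e k =
    Σ (Fin k → Edge) λ m →
      (∀ a → m a ≢ e) × (∀ a b → a ≢ b → VertexDisjoint (m a) (m b))

  IsMatchingNumber : Edge → ℕ → Set
  IsMatchingNumber e k = MatchingIn e k × (∀ k′ → MatchingIn e k′ → k′ ≤ k)

  IsBeta : ℕ → Set
  IsBeta b = (∀ e k → IsMatchingNumber e k → b ≤ k) × ∃ λ e → IsMatchingNumber e b

  numEvenLegs : ℕ
  numEvenLegs = sumFin (λ i → if evenb (ℓ i) then 1 else 0)

  r : ℕ
  r = if Data.Nat._≡ᵇ_ numEvenLegs 1 then 2 else 1

record EdgeColoring (n : ℕ) : Set where
  field
    colour : Fin n → Fin n → ℕ
    symmetric : ∀ i j → i ≢ j → colour i j ≡ colour j i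
open EdgeColoring public

UsesAtLeast : ∀ {n} → EdgeColoring n → ℕ → Set
UsesAtLeast {n} c k =
  Σ (Fin k → Fin n × Fin n) λ f →
    (∀ a → proj₁ (f a) ≢ proj₂ (f a)) ×
    (∀ a b → a ≢ b → colour c (proj₁ (f a)) (proj₂ (f a)) ≢ colour c (proj₁ (f b)) (proj₂ (f b)))

RainbowSpider : ∀ {p n} (ℓ : Fin p → ℕ) → EdgeColoring n → Set
RainbowSpider {p} {n} ℓ c =
  Σ (Vertex → Fin n) λ φ →
    (∀ u v → φ u ≡ φ v → u ≡ v) ×
    (∀ e f → e ≢ f → colour c (φ (child e)) (φ (parent e)) ≢ colour c (φ (child f)) (φ (parent f)))
  where open Spider ℓ

-- ar(K_n, T) ≥ x  (x an integer):  some coloring of K_n with at least x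
-- colors has no rainbow copy of T.
arAtLeast : ∀ {p} (ℓ : Fin p → ℕ) (n : ℕ) (x : ℤ) → Set
arAtLeast ℓ n x =
  Σ (EdgeColoring n) λ c → Σ ℕ λ k →
    UsesAtLeast c k × (x ℤ.≤ + k) × (RainbowSpider ℓ c → Data.Empty.⊥)
  where import Data.Empty

module Submission where

-- Let s = β − 1 and S = {0, …, s − 1} ⊆ V(K_n). Give the s n − C(s + 1, 2) edges meeting S distinct
-- colours and the remaining edges one further colour, or two if r = 2 (the second one only on
-- {s, s + 1}); this uses exactly the bound number of colours. A rainbow copy of T then has at most r
-- edges missing S, and every other edge has an end in S.
-- If r = 1, take the edge e missing S (if any): a matching of T − e with β edges has distinct ends
-- in S on its edges, so β ≤ s.
-- If exactly one leg is even, let e* be its second edge. In T − e* the edges at the center pairwise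
-- meet, and on each leg the remaining edges form paths of even length 2 ⌊(ℓᵢ − 1)/2⌋, so
-- β ≤ ν(T − e*) ≤ 1 + Σ ⌊(ℓᵢ − 1)/2⌋ and |E(T)| = 2 Σ ⌊(ℓᵢ − 1)/2⌋ + p + 1 ≥ 2s + p + 1. But charging
-- each edge meeting S to an end in S (the center has degree p, other vertices degree at most 2)
-- bounds the rainbow copy by 2 + p + 2(s − 1) edges when the center is in S, and by 2 + 2s ≤ p + 2s
-- otherwise.

module SpiderAntiRamsey where
  open import Defs
  open import Data.Bool using (Bool; true; false; if_then_else_; T)
  open import Data.Empty using (⊥; ⊥-elim)
  open import Data.Fin as Fin using (Fin; zero; suc; toℕ; splitAt; join; _↑ˡ_; _↑ʳ_)
  import Data.Fin.Properties as Fin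
  import Data.Integer as ℤ
  import Data.Integer.Properties as ℤ
  open import Data.Integer.Tactic.RingSolver renaming (solve-∀ to ℤ-solve-∀)
  open import Data.Maybe as Maybe using (just; nothing)
  open import Data.Maybe.Properties using (just-injective) renaming (≡-dec to Maybe-≡-dec)
  open import Data.Nat as ℕ using (ℕ; zero; suc; _+_; _*_; _∸_; _≤_; _<_; _⊓_; _⊔_; z≤n; s≤s; ⌊_/2⌋)
  import Data.Nat.Properties as ℕ
  open import Data.Nat.Combinatorics using (_C_; nC1≡n; nCk+nC[k+1]≡[n+1]C[k+1])
  open import Data.Nat.Tactic.RingSolver using (solve-∀)
  open import Data.Product using (Σ; ∃; _×_; _,_; proj₁; proj₂; uncurry)
  open import Data.Product.Properties using (,-injective; ≡-dec)
  open import Data.Sum using (_⊎_; inj₁; inj₂; [_,_]′)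
  open import Data.Sum.Function.Propositional using (_⊎-↔_)
  open import Data.Sum.Properties using (inj₁-injective; inj₂-injective)
  open import Data.Vec.Functional using (Vector; []; _∷_; head; tail)
  open import Function using (_∘_; _↔_; mk↔ₛ′; Injective)
  open import Function.Bundles using (Injection; Inverse)
  open import Function.Properties.Inverse using (↔⇒↣; ↔-sym; ↔-trans; ↔-refl)
  open import Relation.Binary.Definitions using (DecidableEquality)
  open import Relation.Binary.PropositionalEquality
  open import Relation.Nullary using (¬_; Dec; yes; no; ¬?; _×-dec_; _→-dec_)
  open import Relation.Unary using (Decidable)

  sumFin-snoc : ∀ s (g : ℕ → ℕ) → sumFin {suc s} (g ∘ toℕ) ≡ sumFin {s} (g ∘ toℕ) + g s
  sumFin-snoc zero    g = ℕ.+-comm (g 0) 0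
  sumFin-snoc (suc s) g = begin
    g 0 + sumFin {suc s} (g ∘ suc ∘ toℕ)       ≡⟨ cong (g 0 +_) (sumFin-snoc s (g ∘ suc)) ⟩
    g 0 + (sumFin {s} (g ∘ suc ∘ toℕ) + g (suc s)) ≡⟨ ℕ.+-assoc (g 0) _ _ ⟨
    sumFin {suc s} (g ∘ toℕ) + g (suc s)       ∎
    where open ≡-Reasoning

  sumFin-decompose : ∀ {p} (f h e : Fin p → ℕ) → (∀ i → f i ≡ 2 * h i + 1 + e i) →
    sumFin f ≡ 2 * sumFin h + p + sumFin e
  sumFin-decompose {zero}  f h e f≡ = refl
  sumFin-decompose {suc p} f h e f≡ = begin
    f zero + sumFin (f ∘ suc)
      ≡⟨ cong₂ _+_ (f≡ zero) (sumFin-decompose (f ∘ suc) (h ∘ suc) (e ∘ suc) (f≡ ∘ suc)) ⟩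
    (2 * h zero + 1 + e zero) + (2 * sumFin (h ∘ suc) + p + sumFin (e ∘ suc))
      ≡⟨ regroup (h zero) (e zero) (sumFin (h ∘ suc)) p (sumFin (e ∘ suc)) ⟩
    2 * (h zero + sumFin (h ∘ suc)) + suc p + (e zero + sumFin (e ∘ suc)) ∎
    where
    open ≡-Reasoning
    regroup : ∀ a b c d e → (2 * a + 1 + b) + (2 * c + d + e) ≡ 2 * (a + c) + (1 + d) + (b + e)
    regroup = solve-∀

  [_]ᵉ : Bool → ℕ
  [ b ]ᵉ = if b then 1 else 0

  single-true : ∀ {p} (f : Fin p → Bool) → sumFin (λ i → [ f i ]ᵉ) ≡ 1 → ∃ λ i₀ → ∀ i → i ≢ i₀ → f i ≡ false
  single-true {suc p} f sum≡1 with f zero in f0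
  ... | true  = zero , λ { zero 0≢0 → ⊥-elim (0≢0 refl) ; (suc i) _ → none (f ∘ suc) (ℕ.suc-injective sum≡1) i }
    where
    none : ∀ {q} (g : Fin q → Bool) → sumFin (λ i → [ g i ]ᵉ) ≡ 0 → ∀ i → g i ≡ false
    none g sum≡0 zero    with g zero
    ... | false = refl
    none g sum≡0 (suc i) with g zero
    ... | false = none (g ∘ suc) sum≡0 i
  ... | false with single-true (f ∘ suc) sum≡1
  ...   | i₀ , rest = suc i₀ , λ { zero _ → f0 ; (suc i) i≢i₀ → rest i (i≢i₀ ∘ cong suc) }

  private
    toFin : ∀ {p} (f : Fin p → ℕ) → Σ (Fin p) (Fin ∘ f) → Fin (sumFin f)
    toFin {suc p} f (zero  , j) = j ↑ˡ sumFin (f ∘ suc)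
    toFin {suc p} f (suc i , j) = f zero ↑ʳ toFin (f ∘ suc) (i , j)

    fromFin : ∀ {p} (f : Fin p → ℕ) → Fin (sumFin f) → Σ (Fin p) (Fin ∘ f)
    fromFin {suc p} f x with splitAt (f zero) x
    ... | inj₁ j = zero , j
    ... | inj₂ y with fromFin (f ∘ suc) y
    ...   | i , j = suc i , j

    fromFin-toFin : ∀ {p} (f : Fin p → ℕ) x → fromFin f (toFin f x) ≡ x
    fromFin-toFin {suc p} f (zero , j) rewrite Fin.splitAt-↑ˡ (f zero) j (sumFin (f ∘ suc)) = refl
    fromFin-toFin {suc p} f (suc i , j)
      rewrite Fin.splitAt-↑ʳ (f zero) (sumFin (f ∘ suc)) (toFin (f ∘ suc) (i , j))
            | fromFin-toFin (f ∘ suc) (i , j) = refl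

    toFin-fromFin : ∀ {p} (f : Fin p → ℕ) x → toFin f (fromFin f x) ≡ x
    toFin-fromFin {suc p} f x with splitAt (f zero) x in eq
    ... | inj₁ j = trans (cong (join _ _) (sym eq)) (Fin.join-splitAt (f zero) _ x)
    ... | inj₂ y with fromFin (f ∘ suc) y in eq′
    ...   | i , j = begin
      f zero ↑ʳ toFin (f ∘ suc) (i , j)          ≡⟨ cong (λ z → f zero ↑ʳ toFin (f ∘ suc) z) eq′ ⟨
      f zero ↑ʳ toFin (f ∘ suc) (fromFin (f ∘ suc) y) ≡⟨ cong (f zero ↑ʳ_) (toFin-fromFin (f ∘ suc) y) ⟩
      join (f zero) _ (inj₂ y)                     ≡⟨ cong (join _ _) eq ⟨
      join (f zero) _ (splitAt (f zero) x)         ≡⟨ Fin.join-splitAt (f zero) _ x ⟩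
      x                                            ∎
      where open ≡-Reasoning

  Σ↔sumFin : ∀ {p} (f : Fin p → ℕ) → Σ (Fin p) (Fin ∘ f) ↔ Fin (sumFin f)
  Σ↔sumFin f = mk↔ₛ′ (toFin f) (fromFin f) (toFin-fromFin f) (fromFin-toFin f)

  injective⇒≤ : ∀ {A B : Set} {m n} → A ↔ Fin m → B ↔ Fin n → (f : A → B) → Injective _≡_ _≡_ f → m ≤ n
  injective⇒≤ A↔m B↔n f f-inj = Fin.injective⇒≤ λ eq →
    Injection.injective (↔⇒↣ (↔-sym A↔m)) (f-inj (Injection.injective (↔⇒↣ B↔n) eq))

  injective-avoiding⇒≤ : ∀ {A B : Set} {a k m} → A ↔ Fin a → B ↔ Fin m → (c : Fin k → B) → Injective _≡_ _≡_ c →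
    (f : A → B) → Injective _≡_ _≡_ f → (∀ x i → f x ≢ c i) → k + a ≤ m
  injective-avoiding⇒≤ A↔a B↔m c c-inj f f-inj avoids =
    injective⇒≤ (↔-trans (↔-refl ⊎-↔ A↔a) (↔-sym Fin.+↔⊎)) B↔m [ c , f ]′ inj
    where
    inj : Injective _≡_ _≡_ [ c , f ]′
    inj {inj₁ i} {inj₁ j} eq = cong inj₁ (c-inj eq)
    inj {inj₁ i} {inj₂ y} eq = ⊥-elim (avoids y i (sym eq))
    inj {inj₂ x} {inj₁ j} eq = ⊥-elim (avoids x j eq)
    inj {inj₂ x} {inj₂ y} eq = cong inj₂ (f-inj eq)

  Exhaustible : Set → Set₁
  Exhaustible A = ∀ {P : A → Set} → Decidable P → Dec (∃ P)

  Σ-exhaustible : ∀ {p} (f : Fin p → ℕ) → Exhaustible (Σ (Fin p) (Fin ∘ f))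
  Σ-exhaustible f P? with Fin.any? (λ i → Fin.any? (λ j → P? (i , j)))
  ... | yes (i , j , q) = yes ((i , j) , q)
  ... | no ¬q           = no λ ((i , j) , q) → ¬q (i , j , q)

  -- Without function extensionality the predicate has to respect pointwise equality.
  vector-exhaustible : ∀ {A : Set} → Exhaustible A → ∀ k {P : Vector A k → Set} →
    (∀ {u v} → u ≗ v → P u → P v) → Decidable P → Dec (∃ P)
  vector-exhaustible A? zero {P} resp P? with P? []
  ... | yes q = yes ([] , q)
  ... | no ¬q = no λ (u , q) → ¬q (resp (λ ()) q)
  vector-exhaustible A? (suc k) {P} resp P?
    with A? (λ x → vector-exhaustible A? k (λ u≗v → resp (λ { zero → refl ; (suc i) → u≗v i }))
                                           (λ u → P? (x ∷ u)))
  ... | yes (x , u , q) = yes (x ∷ u , q)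
  ... | no ¬q = no λ (u , q) → ¬q (head u , tail u , resp (λ { zero → refl ; (suc i) → refl }) q)

  bounded-maximum : ∀ {P : ℕ → Set} m → Decidable P → P 0 → (∀ {k} → P k → k ≤ m) →
    ∃ λ k → P k × (∀ {k′} → P k′ → k′ ≤ k)
  bounded-maximum m P? P0 bound with P? m
  ... | yes Pm = m , Pm , bound
  bounded-maximum zero    P? P0 bound | no ¬Pm = ⊥-elim (¬Pm P0)
  bounded-maximum (suc m) P? P0 bound | no ¬Pm = bounded-maximum m P? P0 λ Pk →
    ℕ.≤-pred (ℕ.≤∧≢⇒< (bound Pk) λ { refl → ¬Pm Pk })

  suc≡2*⌊/2⌋+1+even : ∀ m → suc m ≡ 2 * ⌊ m /2⌋ + 1 + [ evenb (suc m) ]ᵉ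
  suc≡2*⌊/2⌋+1+even zero          = refl
  suc≡2*⌊/2⌋+1+even (suc zero)    = refl
  suc≡2*⌊/2⌋+1+even (suc (suc m)) = begin
    suc (suc (suc m))                                   ≡⟨ cong (ℕ.suc ∘ ℕ.suc) (suc≡2*⌊/2⌋+1+even m) ⟩
    suc (suc (2 * ⌊ m /2⌋ + 1 + [ evenb (suc m) ]ᵉ))     ≡⟨ cong (λ x → x + 1 + [ evenb (suc m) ]ᵉ) (ℕ.*-suc 2 ⌊ m /2⌋) ⟨
    2 * suc ⌊ m /2⌋ + 1 + [ evenb (suc m) ]ᵉ             ∎
    where open ≡-Reasoning

  <⇒⌊/2⌋< : ∀ {x} h → x < 2 * h → ⌊ x /2⌋ < h
  <⇒⌊/2⌋< {x} zero x<0 = ⊥-elim (ℕ.n≮0 x<0)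
  <⇒⌊/2⌋< {zero}        (suc h) _ = ℕ.z<s
  <⇒⌊/2⌋< {suc zero}    (suc h) _ = ℕ.z<s
  <⇒⌊/2⌋< {suc (suc x)} (suc h) x+2<2h+2 =
    s≤s (<⇒⌊/2⌋< h (ℕ.≤-pred (ℕ.≤-pred (subst (suc (suc (suc x)) ≤_) (ℕ.*-suc 2 h) x+2<2h+2))))

  ⌊/2⌋≡⇒≡⊎adjacent : ∀ x y → ⌊ x /2⌋ ≡ ⌊ y /2⌋ → x ≡ y ⊎ x ≡ suc y ⊎ y ≡ suc x
  ⌊/2⌋≡⇒≡⊎adjacent zero          zero          _ = inj₁ refl
  ⌊/2⌋≡⇒≡⊎adjacent zero          (suc zero)    _ = inj₂ (inj₂ refl)
  ⌊/2⌋≡⇒≡⊎adjacent (suc zero)    zero          _ = inj₂ (inj₁ refl)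
  ⌊/2⌋≡⇒≡⊎adjacent (suc zero)    (suc zero)    _ = inj₁ refl
  ⌊/2⌋≡⇒≡⊎adjacent (suc (suc x)) (suc (suc y)) eq with ⌊/2⌋≡⇒≡⊎adjacent x y (ℕ.suc-injective eq)
  ... | inj₁ x≡y         = inj₁ (cong (ℕ.suc ∘ ℕ.suc) x≡y)
  ... | inj₂ (inj₁ x≡1+y) = inj₂ (inj₁ (cong (ℕ.suc ∘ ℕ.suc) x≡1+y))
  ... | inj₂ (inj₂ y≡1+x) = inj₂ (inj₂ (cong (ℕ.suc ∘ ℕ.suc) y≡1+x))

  x∸o≡k+[y∸o]⇒x≡k+y : ∀ k {x y o} → o ≤ x → o ≤ y → x ∸ o ≡ k + (y ∸ o) → x ≡ k + y
  x∸o≡k+[y∸o]⇒x≡k+y k {x} {y} {o} o≤x o≤y eq = begin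
    x                  ≡⟨ ℕ.m∸n+n≡m o≤x ⟨
    x ∸ o + o          ≡⟨ cong (_+ o) eq ⟩
    k + (y ∸ o) + o    ≡⟨ ℕ.+-assoc k (y ∸ o) o ⟩
    k + (y ∸ o + o)    ≡⟨ cong (k +_) (ℕ.m∸n+n≡m o≤y) ⟩
    k + y              ∎
    where open ≡-Reasoning

  prev≡just : ∀ {m} {j : Fin m} {j′} → prev j ≡ just j′ → toℕ j ≡ suc (toℕ j′)
  prev≡just {j = suc j} refl = cong suc (sym (Fin.toℕ-inject₁ j))

  prev≡nothing : ∀ {m} {j : Fin m} → prev j ≡ nothing → toℕ j ≡ 0
  prev≡nothing {j = zero} _ = refl

  toℕ≡suc⇒prev : ∀ {m} {j j′ : Fin m} → toℕ j ≡ suc (toℕ j′) → prev j ≡ just j′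
  toℕ≡suc⇒prev {j = suc j} eq = cong just (Fin.toℕ-injective (trans (Fin.toℕ-inject₁ j) (ℕ.suc-injective eq)))

  toℕ≡0⇒prev : ∀ {m} {j : Fin m} → toℕ j ≡ 0 → prev j ≡ nothing
  toℕ≡0⇒prev {j = zero} _ = refl

  module SpiderProperties {p : ℕ} (ℓ : Fin p → ℕ) where
    open Spider ℓ

    _≟ᴱ_ : DecidableEquality Edge
    _≟ᴱ_ = ≡-dec Fin._≟_ Fin._≟_

    _≟ⱽ_ : DecidableEquality Vertex
    _≟ⱽ_ = Maybe-≡-dec _≟ᴱ_

    edges↔ : Edge ↔ Fin (sumFin ℓ)
    edges↔ = Σ↔sumFin ℓ

    Ends : Vertex → Edge → Set
    Ends u g = u ≡ child g ⊎ u ≡ parent g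

    slot : ∀ {u g} → Ends u g → Fin 2
    slot (inj₁ _) = zero
    slot (inj₂ _) = suc zero

    common-end⇒¬disjoint : ∀ {u g h} → Ends u g → Ends u h → ¬ VertexDisjoint g h
    common-end⇒¬disjoint (inj₁ a) (inj₁ b) (d , _ , _ , _) = d (trans (sym a) b)
    common-end⇒¬disjoint (inj₁ a) (inj₂ b) (_ , d , _ , _) = d (trans (sym a) b)
    common-end⇒¬disjoint (inj₂ a) (inj₁ b) (_ , _ , d , _) = d (trans (sym a) b)
    common-end⇒¬disjoint (inj₂ a) (inj₂ b) (_ , _ , _ , d) = d (trans (sym a) b)

    VertexDisjoint-sym : ∀ {g h} → VertexDisjoint g h → VertexDisjoint h g
    VertexDisjoint-sym (d₁ , d₂ , d₃ , d₄) = d₁ ∘ sym , d₃ ∘ sym , d₂ ∘ sym , d₄ ∘ sym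

    parent≡just : ∀ {i i′} {j : Fin (ℓ i)} {j′ : Fin (ℓ i′)} → parent (i , j) ≡ just (i′ , j′) → i ≡ i′ × toℕ j ≡ suc (toℕ j′)
    parent≡just {j = j} eq with prev j in eq′
    parent≡just refl | just _ = refl , prev≡just eq′

    parent≡nothing : ∀ {i} {j : Fin (ℓ i)} → parent (i , j) ≡ nothing → toℕ j ≡ 0
    parent≡nothing {j = j} eq with prev j in eq′
    parent≡nothing refl | nothing = prev≡nothing eq′

    edge-≡ : ∀ {g h : Edge} → proj₁ g ≡ proj₁ h → toℕ (proj₂ g) ≡ toℕ (proj₂ h) → g ≡ h
    edge-≡ {i , _} refl eq = cong (i ,_) (Fin.toℕ-injective eq)

    parent-injective : ∀ {g h w} → parent g ≡ just w → parent h ≡ just w → g ≡ h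
    parent-injective {i , j} {i′ , j′} {_ , _} pg ph with parent≡just {i} {j = j} pg | parent≡just {i′} {j = j′} ph
    ... | refl , jg | refl , jh = edge-≡ refl (trans jg (sym jh))

    center-edge-unique : ∀ {g h} → parent g ≡ nothing → parent h ≡ nothing → proj₁ g ≡ proj₁ h → g ≡ h
    center-edge-unique {i , j} {_ , j′} pg ph refl =
      edge-≡ refl (trans (parent≡nothing {i} {j} pg) (sym (parent≡nothing {i} {j′} ph)))

    ends-injective : ∀ {u g h} (eg : Ends u g) (eh : Ends u h) → slot eg ≡ slot eh → u ≢ nothing → g ≡ h
    ends-injective (inj₁ a) (inj₁ b) _ _ = just-injective (trans (sym a) b)
    ends-injective {just w} (inj₂ a) (inj₂ b) _ _ = parent-injective (sym a) (sym b)
    ends-injective {nothing} (inj₂ _) (inj₂ _) _ u≢∅ = ⊥-elim (u≢∅ refl)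

    consecutive-edges-meet : ∀ {i} {j j′ : Fin (ℓ i)} → toℕ j ≡ suc (toℕ j′) → ¬ VertexDisjoint (i , j) (i , j′)
    consecutive-edges-meet {i} eq = common-end⇒¬disjoint (inj₂ (sym (cong (Maybe.map (i ,_)) (toℕ≡suc⇒prev eq)))) (inj₁ refl)

    center-edges-meet : ∀ {i i′} {j : Fin (ℓ i)} {j′ : Fin (ℓ i′)} → toℕ j ≡ 0 → toℕ j′ ≡ 0 → ¬ VertexDisjoint (i , j) (i′ , j′)
    center-edges-meet {i} {i′} j≡0 j′≡0 =
      common-end⇒¬disjoint (inj₂ (sym (cong (Maybe.map (i ,_)) (toℕ≡0⇒prev j≡0)))) (inj₂ (sym (cong (Maybe.map (i′ ,_)) (toℕ≡0⇒prev j′≡0))))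

    Matches : Edge → ∀ {k} → (Fin k → Edge) → Set
    Matches e m = (∀ a → m a ≢ e) × (∀ a b → a ≢ b → VertexDisjoint (m a) (m b))

    vertexDisjoint? : ∀ e f → Dec (VertexDisjoint e f)
    vertexDisjoint? e f = ¬? (child e ≟ⱽ child f) ×-dec ¬? (child e ≟ⱽ parent f) ×-dec
                          ¬? (parent e ≟ⱽ child f) ×-dec ¬? (parent e ≟ⱽ parent f)

    matching? : ∀ e k → Dec (MatchingIn e k)
    matching? e k = vector-exhaustible (Σ-exhaustible ℓ) k respects λ m →
      Fin.all? (λ a → ¬? (m a ≟ᴱ e)) ×-dec
      Fin.all? (λ a → Fin.all? λ b → ¬? (a Fin.≟ b) →-dec vertexDisjoint? (m a) (m b))
      where
      respects : ∀ {m m′ : Fin k → Edge} → m ≗ m′ → Matches e m → Matches e m′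
      respects m≗m′ (avoids , disjoint) =
        (λ a eq → avoids a (trans (m≗m′ a) eq)) ,
        λ a b a≢b → subst₂ VertexDisjoint (m≗m′ a) (m≗m′ b) (disjoint a b a≢b)

    matching-injective : ∀ {e k} (M : MatchingIn e k) → Injective _≡_ _≡_ (proj₁ M)
    matching-injective (_ , _ , disjoint) {a} {b} eq with a Fin.≟ b
    ... | yes a≡b = a≡b
    ... | no a≢b  = ⊥-elim (proj₁ (disjoint a b a≢b) (cong just eq))

    matching-size≤ : ∀ {e k} → MatchingIn e k → k ≤ sumFin ℓ
    matching-size≤ M = injective⇒≤ ↔-refl edges↔ (proj₁ M) (matching-injective M)

    matching-shrink : ∀ {e k k′} → k′ ≤ k → MatchingIn e k → MatchingIn e k′
    matching-shrink k′≤k (m , avoids , disjoint) =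
      m ∘ (λ a → Fin.inject≤ a k′≤k) , avoids ∘ (λ a → Fin.inject≤ a k′≤k) ,
      λ a b a≢b → disjoint _ _ (a≢b ∘ Fin.inject≤-injective k′≤k k′≤k a b)

    matchingNumber : ∀ e → ∃ (IsMatchingNumber e)
    matchingNumber e with bounded-maximum (sumFin ℓ) (matching? e) ((λ ()) , (λ ()) , λ ()) matching-size≤
    ... | k , M , maximal = k , M , λ _ → maximal

    β-matching : ∀ {β} → IsBeta β → ∀ e → MatchingIn e β
    β-matching (β-minimal , _) e with matchingNumber e
    ... | k , ν = matching-shrink (β-minimal e k ν) (proj₁ ν)

    another-edge : ∀ {i} → 2 ≤ ℓ i → ∀ e → ∃ λ g → g ≢ e
    another-edge {i} 2≤ℓi e = pick (e ≟ᴱ first)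
      where
      first second : Edge
      first  = i , Fin.fromℕ< (ℕ.<-trans ℕ.z<s 2≤ℓi)
      second = i , Fin.fromℕ< 2≤ℓi
      first≢second : first ≢ second
      first≢second eq = ℕ.0≢1+n (trans (sym (Fin.toℕ-fromℕ< _)) (trans (cong (toℕ ∘ proj₂) eq) (Fin.toℕ-fromℕ< 2≤ℓi)))
      pick : Dec (e ≡ first) → ∃ λ g → g ≢ e
      pick (yes e≡first) = second , λ second≡e → first≢second (trans (sym e≡first) (sym second≡e))
      pick (no e≢first)  = first , e≢first ∘ sym

    β-positive : ∀ {i} → 2 ≤ ℓ i → ∀ {β} → IsBeta β → 1 ≤ β
    β-positive 2≤ℓi (_ , e₀ , _ , maximal) with another-edge 2≤ℓi e₀
    ... | g , g≢e₀ = maximal 1 ((λ _ → g) , (λ _ → g≢e₀) , λ { zero zero 0≢0 → ⊥-elim (0≢0 refl) })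

  module _ {n} (c : EdgeColoring n) where

    pairColour : Fin n × Fin n → ℕ
    pairColour (x , y) = colour c x y

    uses-++ : ∀ {k j} (F : UsesAtLeast c k) (G : UsesAtLeast c j) →
      (∀ a b → pairColour (proj₁ F a) ≢ pairColour (proj₁ G b)) → UsesAtLeast c (k + j)
    uses-++ {k} (f , f-proper , f-rainbow) (g , g-proper , g-rainbow) disjoint = h , h-proper , h-rainbow
      where
      h : Fin (k + _) → Fin n × Fin n
      h z = [ f , g ]′ (splitAt k z)
      h-proper : ∀ z → proj₁ (h z) ≢ proj₂ (h z)
      h-proper z with splitAt k z
      ... | inj₁ a = f-proper a
      ... | inj₂ b = g-proper b
      splitAt-injective : ∀ {z z′} → splitAt k z ≡ splitAt k z′ → z ≡ z′
      splitAt-injective = Injection.injective (↔⇒↣ Fin.+↔⊎)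
      h-rainbow : ∀ z z′ → z ≢ z′ → pairColour (h z) ≢ pairColour (h z′)
      h-rainbow z z′ z≢z′ eq with splitAt k z in ez | splitAt k z′ in ez′
      ... | inj₁ a | inj₁ a′ = f-rainbow a a′ (λ { refl → z≢z′ (splitAt-injective (trans ez (sym ez′))) }) eq
      ... | inj₁ a | inj₂ b′ = disjoint a b′ eq
      ... | inj₂ b | inj₁ a′ = disjoint a′ b (sym eq)
      ... | inj₂ b | inj₂ b′ = g-rainbow b b′ (λ { refl → z≢z′ (splitAt-injective (trans ez (sym ez′))) }) eq

  lightCount : Bool → ℕ
  lightCount b = if b then 2 else 1

  pred[lightCount]< : ∀ b → ℕ.pred (lightCount b) < lightCount b
  pred[lightCount]< false = ℕ.≤-refl
  pred[lightCount]< true  = ℕ.≤-refl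

  -- S = {0, …, s − 1}. An edge {x, y} with x < y gets colour 2 + n x + y if x ∈ S; otherwise
  -- colour min (y − s − 1, lightCount b − 1), so that only {s, s + 1} can be told apart.
  module Colouring (n s : ℕ) where

    lightColour : Bool → ℕ → ℕ
    lightColour b y = (y ∸ suc s) ⊓ ℕ.pred (lightCount b)

    orderedColour : Bool → ℕ → ℕ → ℕ
    orderedColour b x y with x ℕ.<? s
    ... | yes _ = 2 + (n * x + y)
    ... | no _  = lightColour b y

    colouring : Bool → EdgeColoring n
    colouring b = record
      { colour    = λ i j → orderedColour b (toℕ i ⊓ toℕ j) (toℕ i ⊔ toℕ j)
      ; symmetric = λ i j _ → cong₂ (orderedColour b) (ℕ.⊓-comm (toℕ i) (toℕ j)) (ℕ.⊔-comm (toℕ i) (toℕ j))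
      }

    colour-≤ : ∀ b {i j} → toℕ i ≤ toℕ j → colour (colouring b) i j ≡ orderedColour b (toℕ i) (toℕ j)
    colour-≤ b i≤j = cong₂ (orderedColour b) (ℕ.m≤n⇒m⊓n≡m i≤j) (ℕ.m≤n⇒m⊔n≡n i≤j)

    orderedColour-heavy : ∀ b {x} y → x < s → orderedColour b x y ≡ 2 + (n * x + y)
    orderedColour-heavy b {x} y x<s with x ℕ.<? s
    ... | yes _  = refl
    ... | no x≮s = ⊥-elim (x≮s x<s)

    orderedColour-light : ∀ b {x} y → s ≤ x → orderedColour b x y ≡ lightColour b y
    orderedColour-light b {x} y s≤x with x ℕ.<? s
    ... | yes x<s = ⊥-elim (ℕ.<⇒≱ x<s s≤x)
    ... | no _    = refl

    lightColour< : ∀ b y → lightColour b y < lightCount b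
    lightColour< b y = ℕ.≤-<-trans (ℕ.m⊓n≤n _ _) (pred[lightCount]< b)

    colour-outside< : ∀ b {i j} → s ≤ toℕ i → s ≤ toℕ j → colour (colouring b) i j < lightCount b
    colour-outside< b {i} {j} s≤i s≤j =
      subst (_< lightCount b) (sym (orderedColour-light b _ (ℕ.⊓-glb s≤i s≤j))) (lightColour< b (toℕ i ⊔ toℕ j))

    heavyCount : ℕ
    heavyCount = sumFin {s} (λ a → n ∸ suc (toℕ a))

    module _ (s≤n : s ≤ n) where

      HeavyIndex : Set
      HeavyIndex = Σ (Fin s) (λ a → Fin (n ∸ suc (toℕ a)))

      heavyEdge : HeavyIndex → Fin n × Fin n
      heavyEdge (a , w) = Fin.fromℕ< a<n , Fin.fromℕ< a+1+w<n
        where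
        a<n : toℕ a < n
        a<n = ℕ.<-≤-trans (Fin.toℕ<n a) s≤n
        a+1+w<n : suc (toℕ a + toℕ w) < n
        a+1+w<n = subst (suc (toℕ a + toℕ w) <_) (ℕ.m+[n∸m]≡n a<n) (ℕ.+-monoʳ-< (suc (toℕ a)) (Fin.toℕ<n w))

      heavyEdge-first : ∀ a w → toℕ (proj₁ (heavyEdge (a , w))) ≡ toℕ a
      heavyEdge-first a w = Fin.toℕ-fromℕ< _

      heavyEdge-second : ∀ a w → toℕ (proj₂ (heavyEdge (a , w))) ≡ suc (toℕ a + toℕ w)
      heavyEdge-second a w = Fin.toℕ-fromℕ< _

      heavyEdge-< : ∀ x → toℕ (proj₁ (heavyEdge x)) < toℕ (proj₂ (heavyEdge x))
      heavyEdge-< (a , w) = subst₂ _<_ (sym (heavyEdge-first a w)) (sym (heavyEdge-second a w)) (s≤s (ℕ.m≤m+n (toℕ a) (toℕ w)))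

      heavyEdge-injective : Injective _≡_ _≡_ heavyEdge
      heavyEdge-injective {a , w} {a′ , w′} eq
        with refl ← Fin.toℕ-injective {i = a} {a′} (trans (sym (heavyEdge-first a w)) (trans (cong (toℕ ∘ proj₁) eq) (heavyEdge-first a′ w′)))
        = cong (a ,_) (Fin.toℕ-injective (ℕ.+-cancelˡ-≡ (toℕ a) _ _ (ℕ.suc-injective
            (trans (sym (heavyEdge-second a w)) (trans (cong (toℕ ∘ proj₂) eq) (heavyEdge-second a w′))))))

      heavyEdge-colour : ∀ b x → pairColour (colouring b) (heavyEdge x) ≡ 2 + toℕ (uncurry Fin.combine (heavyEdge x))
      heavyEdge-colour b (a , w) = begin
        colour (colouring b) x y         ≡⟨ colour-≤ b (ℕ.<⇒≤ (heavyEdge-< (a , w))) ⟩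
        orderedColour b (toℕ x) (toℕ y)  ≡⟨ orderedColour-heavy b (toℕ y) (subst (_< s) (sym (heavyEdge-first a w)) (Fin.toℕ<n a)) ⟩
        2 + (n * toℕ x + toℕ y)          ≡⟨ cong (2 +_) (Fin.toℕ-combine x y) ⟨
        2 + toℕ (Fin.combine x y)        ∎
        where
        open ≡-Reasoning
        x y : Fin n
        x = proj₁ (heavyEdge (a , w))
        y = proj₂ (heavyEdge (a , w))

      heavy-uses : ∀ b → Σ (UsesAtLeast (colouring b) heavyCount) λ H → ∀ z → 2 ≤ pairColour (colouring b) (proj₁ H z)
      heavy-uses b = (edge , proper , rainbow) , λ z → subst (2 ≤_) (sym (heavyEdge-colour b (index z))) (s≤s (s≤s z≤n))
        where
        index : Fin heavyCount → HeavyIndex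
        index = Inverse.from (Σ↔sumFin _)
        edge : Fin heavyCount → Fin n × Fin n
        edge = heavyEdge ∘ index
        proper : ∀ z → proj₁ (edge z) ≢ proj₂ (edge z)
        proper z eq = ℕ.<-irrefl (cong toℕ eq) (heavyEdge-< (index z))
        rainbow : ∀ z z′ → z ≢ z′ → pairColour (colouring b) (edge z) ≢ pairColour (colouring b) (edge z′)
        rainbow z z′ z≢z′ eq = z≢z′ (Injection.injective (↔⇒↣ (↔-sym (Σ↔sumFin _))) (heavyEdge-injective
          (uncurry (cong₂ _,_) (Fin.combine-injective _ _ _ _ (Fin.toℕ-injective (ℕ.suc-injective (ℕ.suc-injective
            (trans (sym (heavyEdge-colour b (index z))) (trans eq (heavyEdge-colour b (index z′)))))))))))

    module _ (b : Bool) (room : s + lightCount b < n) where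

      lightEdge : Fin (lightCount b) → Fin n × Fin n
      lightEdge t = Fin.fromℕ< (ℕ.≤-<-trans (ℕ.m≤m+n s _) room) , Fin.fromℕ< s+1+t<n
        where
        s+1+t<n : suc (s + toℕ t) < n
        s+1+t<n = ℕ.≤-<-trans (ℕ.+-monoʳ-< s (Fin.toℕ<n t)) room

      lightEdge-colour : ∀ t → pairColour (colouring b) (lightEdge t) ≡ toℕ t
      lightEdge-colour t = begin
        colour (colouring b) x y         ≡⟨ colour-≤ b (subst₂ _≤_ (sym x≡s) (sym y≡1+s+t) (ℕ.m≤n⇒m≤1+n (ℕ.m≤m+n s (toℕ t)))) ⟩
        orderedColour b (toℕ x) (toℕ y)  ≡⟨ orderedColour-light b (toℕ y) (ℕ.≤-reflexive (sym x≡s)) ⟩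
        lightColour b (toℕ y)            ≡⟨ cong (λ z → (z ∸ suc s) ⊓ ℕ.pred (lightCount b)) y≡1+s+t ⟩
        (s + toℕ t ∸ s) ⊓ ℕ.pred (lightCount b) ≡⟨ cong (_⊓ ℕ.pred (lightCount b)) (ℕ.m+n∸m≡n s (toℕ t)) ⟩
        toℕ t ⊓ ℕ.pred (lightCount b)    ≡⟨ ℕ.m≤n⇒m⊓n≡m (ℕ.<⇒≤pred (Fin.toℕ<n t)) ⟩
        toℕ t                            ∎
        where
        open ≡-Reasoning
        x y : Fin n
        x = proj₁ (lightEdge t)
        y = proj₂ (lightEdge t)
        x≡s : toℕ x ≡ s
        x≡s = Fin.toℕ-fromℕ< _
        y≡1+s+t : toℕ y ≡ suc (s + toℕ t)
        y≡1+s+t = Fin.toℕ-fromℕ< _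

      light-uses : Σ (UsesAtLeast (colouring b) (lightCount b)) λ L → ∀ t → pairColour (colouring b) (proj₁ L t) < 2
      light-uses = (lightEdge , proper , rainbow) , λ t → subst (_< 2) (sym (lightEdge-colour t)) (ℕ.<-≤-trans (Fin.toℕ<n t) (lightCount≤2 b))
        where
        proper : ∀ t → proj₁ (lightEdge t) ≢ proj₂ (lightEdge t)
        proper t eq = ℕ.<-irrefl (trans (sym (Fin.toℕ-fromℕ< _)) (trans (cong toℕ eq) (Fin.toℕ-fromℕ< _))) (s≤s (ℕ.m≤m+n s (toℕ t)))
        rainbow : ∀ t t′ → t ≢ t′ → pairColour (colouring b) (lightEdge t) ≢ pairColour (colouring b) (lightEdge t′)
        rainbow t t′ t≢t′ eq = t≢t′ (Fin.toℕ-injective (trans (sym (lightEdge-colour t)) (trans eq (lightEdge-colour t′))))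
        lightCount≤2 : ∀ b → lightCount b ≤ 2
        lightCount≤2 false = s≤s z≤n
        lightCount≤2 true  = ℕ.≤-refl

    colouring-uses : ∀ b → s ≤ n → s + lightCount b < n → UsesAtLeast (colouring b) (heavyCount + lightCount b)
    colouring-uses b s≤n room = uses-++ (colouring b) (proj₁ heavy) (proj₁ light) λ z t eq →
      ℕ.<⇒≱ (proj₂ light t) (subst (2 ≤_) eq (proj₂ heavy z))
      where
      heavy : Σ (UsesAtLeast (colouring b) heavyCount) λ H → ∀ z → 2 ≤ pairColour (colouring b) (proj₁ H z)
      heavy = heavy-uses s≤n b
      light : Σ (UsesAtLeast (colouring b) (lightCount b)) λ L → ∀ t → pairColour (colouring b) (proj₁ L t) < 2
      light = light-uses b room

  heavyCount+[1+s]C2 : ∀ {n} s → s ≤ n → Colouring.heavyCount n s + suc s C 2 ≡ s * n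
  heavyCount+[1+s]C2 zero _ = refl
  heavyCount+[1+s]C2 {n} (suc s) 1+s≤n = begin
    H (suc s) + suc (suc s) C 2
      ≡⟨ cong₂ _+_ (sumFin-snoc s (λ t → n ∸ suc t)) (sym (nCk+nC[k+1]≡[n+1]C[k+1] (suc s) 1)) ⟩
    (H s + (n ∸ suc s)) + (suc s C 1 + suc s C 2)
      ≡⟨ cong (λ z → (H s + (n ∸ suc s)) + (z + suc s C 2)) (nC1≡n (suc s)) ⟩
    (H s + (n ∸ suc s)) + (suc s + suc s C 2)
      ≡⟨ regroup (H s) (n ∸ suc s) (suc s) (suc s C 2) ⟩
    (H s + suc s C 2) + ((n ∸ suc s) + suc s)
      ≡⟨ cong₂ _+_ (heavyCount+[1+s]C2 s (ℕ.<⇒≤ 1+s≤n)) (ℕ.m∸n+n≡m 1+s≤n) ⟩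
    s * n + n
      ≡⟨ ℕ.+-comm (s * n) n ⟩
    suc s * n ∎
    where
    open ≡-Reasoning
    H : ℕ → ℕ
    H = Colouring.heavyCount n
    regroup : ∀ a b c d → (a + b) + (c + d) ≡ (a + d) + (b + c)
    regroup = solve-∀

  colour-count : ∀ n s r → s ≤ n →
    (((ℤ.+ suc s ℤ.- ℤ.+ 1) ℤ.* ℤ.+ n) ℤ.- ℤ.+ (suc s C 2)) ℤ.+ ℤ.+ r ≡ ℤ.+ (Colouring.heavyCount n s + r)
  colour-count n s r s≤n = begin
    (ℤ.+ 1 ℤ.+ ℤ.+ s ℤ.- ℤ.+ 1) ℤ.* ℤ.+ n ℤ.- ℤ.+ c ℤ.+ ℤ.+ r ≡⟨ drop-1 (ℤ.+ s) (ℤ.+ n) (ℤ.+ c) (ℤ.+ r) ⟩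
    ℤ.+ s ℤ.* ℤ.+ n ℤ.- ℤ.+ c ℤ.+ ℤ.+ r                        ≡⟨ cong (λ z → z ℤ.- ℤ.+ c ℤ.+ ℤ.+ r) s*n≡H+c ⟩
    ℤ.+ H ℤ.+ ℤ.+ c ℤ.- ℤ.+ c ℤ.+ ℤ.+ r                        ≡⟨ cancel (ℤ.+ H) (ℤ.+ c) (ℤ.+ r) ⟩
    ℤ.+ H ℤ.+ ℤ.+ r                                            ≡⟨ ℤ.pos-+ H r ⟨
    ℤ.+ (H + r)                                                ∎
    where
    open ≡-Reasoning
    H c : ℕ
    H = Colouring.heavyCount n s
    c = suc s C 2
    s*n≡H+c : ℤ.+ s ℤ.* ℤ.+ n ≡ ℤ.+ H ℤ.+ ℤ.+ c
    s*n≡H+c = trans (sym (ℤ.pos-* s n)) (trans (cong ℤ.+_ (sym (heavyCount+[1+s]C2 s s≤n))) (ℤ.pos-+ H c))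
    drop-1 : ∀ (x y z w : ℤ.ℤ) → (ℤ.+ 1 ℤ.+ x ℤ.- ℤ.+ 1) ℤ.* y ℤ.- z ℤ.+ w ≡ x ℤ.* y ℤ.- z ℤ.+ w
    drop-1 = ℤ-solve-∀
    cancel : ∀ (x y z : ℤ.ℤ) → x ℤ.+ y ℤ.- y ℤ.+ z ≡ x ℤ.+ z
    cancel = ℤ-solve-∀

  module RainbowCopy {p} (ℓ : Fin p → ℕ) (n s : ℕ) (b : Bool)
    (copy : RainbowSpider ℓ (Colouring.colouring n s b)) where
    open Spider ℓ
    open SpiderProperties ℓ
    open Colouring n s

    φ : Vertex → Fin n
    φ = proj₁ copy

    edgeColour : Edge → ℕ
    edgeColour g = colour (colouring b) (φ (child g)) (φ (parent g))

    edgeColour-injective : Injective _≡_ _≡_ edgeColour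
    edgeColour-injective {g} {h} eq with g ≟ᴱ h
    ... | yes g≡h = g≡h
    ... | no g≢h  = ⊥-elim (proj₂ (proj₂ copy) g h g≢h eq)

    InS : Vertex → Set
    InS u = toℕ (φ u) < s

    label : ∀ {u} → InS u → Fin s
    label u∈S = Fin.fromℕ< u∈S

    label-injective : ∀ {u u′} (u∈S : InS u) (u′∈S : InS u′) → label u∈S ≡ label u′∈S → u ≡ u′
    label-injective u∈S u′∈S eq = proj₁ (proj₂ copy) _ _ (Fin.toℕ-injective
      (trans (sym (Fin.toℕ-fromℕ< u∈S)) (trans (cong toℕ eq) (Fin.toℕ-fromℕ< u′∈S))))

    Light : Edge → Set
    Light g = s ≤ toℕ (φ (child g)) × s ≤ toℕ (φ (parent g))

    light? : ∀ g → Dec (Light g)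
    light? g = (s ℕ.≤? toℕ (φ (child g))) ×-dec (s ℕ.≤? toℕ (φ (parent g)))

    light-colour< : ∀ {g} → Light g → edgeColour g < lightCount b
    light-colour< (s≤child , s≤parent) = colour-outside< b s≤child s≤parent

    HeavyEnd : Edge → Set
    HeavyEnd g = Σ Vertex λ u → Ends u g × InS u

    heavy-end : ∀ g → ¬ Light g → HeavyEnd g
    heavy-end g ¬light with toℕ (φ (child g)) ℕ.<? s | toℕ (φ (parent g)) ℕ.<? s
    ... | yes child∈S | _          = child g , inj₁ refl , child∈S
    ... | no _        | yes parent∈S = parent g , inj₂ refl , parent∈S
    ... | no child∉S  | no parent∉S  = ⊥-elim (¬light (ℕ.≮⇒≥ child∉S , ℕ.≮⇒≥ parent∉S))

    -- Distinct edges of a matching cannot share their end in S.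
    heavy-matching≤s : ∀ {e k} (M : MatchingIn e k) → (∀ a → ¬ Light (proj₁ M a)) → k ≤ s
    heavy-matching≤s {k = k} (m , _ , disjoint) heavy = Fin.injective⇒≤ {f = end-label} end-label-injective
      where
      end : ∀ a → HeavyEnd (m a)
      end a = heavy-end (m a) (heavy a)
      end-label : Fin k → Fin s
      end-label a = label (proj₂ (proj₂ (end a)))
      end-label-injective : Injective _≡_ _≡_ end-label
      end-label-injective {a} {a′} eq with a Fin.≟ a′
      ... | yes a≡a′ = a≡a′
      ... | no a≢a′  = ⊥-elim (common-end⇒¬disjoint (proj₁ (proj₂ (end a))) end-a′ (disjoint a a′ a≢a′))
        where
        end-a′ : Ends (proj₁ (end a)) (m a′)
        end-a′ = subst (λ u → Ends u (m a′))
          (sym (label-injective (proj₂ (proj₂ (end a))) (proj₂ (proj₂ (end a′))) eq)) (proj₁ (proj₂ (end a′)))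

    unique-light⇒β≤s : (∀ {g h} → Light g → Light h → g ≡ h) → ∀ {β} → IsBeta β → β ≤ s
    unique-light⇒β≤s unique isβ with Σ-exhaustible ℓ light?
    ... | yes (e , light-e) = heavy-matching≤s (β-matching isβ e) λ a light-a →
            proj₁ (proj₂ (β-matching isβ e)) a (unique light-a light-e)
    ... | no ¬light = heavy-matching≤s (β-matching isβ (proj₁ (proj₂ isβ))) λ a light-a → ¬light (_ , light-a)

    HeavyCode : Set
    HeavyCode = Fin p ⊎ (Fin s × Fin 2)

    Code : Set
    Code = Fin (lightCount b) ⊎ HeavyCode

    code↔ : Code ↔ Fin (lightCount b + (p + s * 2))
    code↔ = ↔-sym (↔-trans Fin.+↔⊎ (↔-refl ⊎-↔ (↔-trans Fin.+↔⊎ (↔-refl ⊎-↔ Fin.*↔×))))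

    -- An edge whose end in S is the center is determined by its leg.
    heavyCode : ∀ {g} → HeavyEnd g → HeavyCode
    heavyCode {g} (nothing , _)       = inj₁ (proj₁ g)
    heavyCode     (just _ , end , u∈S) = inj₂ (label u∈S , slot end)

    code : ∀ g → Dec (Light g) → Code
    code g (yes light) = inj₁ (Fin.fromℕ< (light-colour< light))
    code g (no ¬light) = inj₂ (heavyCode (heavy-end g ¬light))

    center-end⇒parent : ∀ {g} → Ends nothing g → parent g ≡ nothing
    center-end⇒parent (inj₂ eq) = sym eq

    heavyCode-injective : ∀ {g h} (x : HeavyEnd g) (y : HeavyEnd h) → heavyCode x ≡ heavyCode y → g ≡ h
    heavyCode-injective (nothing , end , _) (nothing , end′ , _) refl =
      center-edge-unique (center-end⇒parent end) (center-end⇒parent end′) refl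
    heavyCode-injective (just _ , end , u∈S) (just _ , end′ , u′∈S) eq
      with l≡l′ , σ≡σ′ ← ,-injective (inj₂-injective eq)
      with refl ← label-injective u∈S u′∈S l≡l′ = ends-injective end end′ σ≡σ′ λ ()

    code-injective : ∀ {g h} dg dh → code g dg ≡ code h dh → g ≡ h
    code-injective (yes _) (yes _) eq = edgeColour-injective
      (trans (sym (Fin.toℕ-fromℕ< _)) (trans (cong toℕ (inj₁-injective eq)) (Fin.toℕ-fromℕ< _)))
    code-injective (no _)  (no _)  eq = heavyCode-injective _ _ (inj₂-injective eq)

    encode : Edge → Code
    encode g = code g (light? g)

    encode-injective : Injective _≡_ _≡_ encode
    encode-injective = code-injective _ _

    heavyCode-avoids-center : ∀ {g} (x : HeavyEnd g) (center∈S : InS nothing) σ → heavyCode x ≢ inj₂ (label center∈S , σ)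
    heavyCode-avoids-center (just _ , _ , u∈S) center∈S σ eq
      with () ← label-injective u∈S center∈S (proj₁ (,-injective (inj₂-injective eq)))

    heavyCode-avoids-legs : ¬ InS nothing → ∀ {g} (x : HeavyEnd g) i → heavyCode x ≢ inj₁ i
    heavyCode-avoids-legs center∉S (nothing , _ , center∈S) _ _ = center∉S center∈S

    encode-avoids : ∀ {c} → (∀ {g} (x : HeavyEnd g) → heavyCode x ≢ c) → ∀ g → encode g ≢ inj₂ c
    encode-avoids avoids g with light? g
    ... | no ¬light = avoids (heavy-end g ¬light) ∘ inj₂-injective

    -- Either the center is in S and the two codes of its label are unused, or no edge is coded by its leg.
    edges≤ : 2 ≤ p → 2 + sumFin ℓ ≤ lightCount b + (p + s * 2)
    edges≤ 2≤p with toℕ (φ nothing) ℕ.<? s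
    ... | yes center∈S =
      injective-avoiding⇒≤ edges↔ code↔ (λ σ → inj₂ (inj₂ (label center∈S , σ)))
        (proj₂ ∘ ,-injective ∘ inj₂-injective ∘ inj₂-injective) encode encode-injective
        λ g σ → encode-avoids (λ x → heavyCode-avoids-center x center∈S σ) g
    ... | no center∉S =
      injective-avoiding⇒≤ edges↔ code↔ (λ σ → inj₂ (inj₁ (Fin.inject≤ σ 2≤p)))
        (Fin.inject≤-injective 2≤p 2≤p _ _ ∘ inj₁-injective ∘ inj₂-injective) encode encode-injective
        λ g σ → encode-avoids (λ x → heavyCode-avoids-legs center∉S x _) g

  module OneEvenLeg {p} (ℓ : Fin p → ℕ) (legs≥2 : ∀ i → 2 ≤ ℓ i) (i₀ : Fin p)
    (odd-elsewhere : ∀ i → i ≢ i₀ → evenb (ℓ i) ≡ false) where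
    open Spider ℓ
    open SpiderProperties ℓ

    H : Fin p → ℕ
    H i = ⌊ ℓ i ∸ 1 /2⌋

    leg-length : ∀ i → ℓ i ≡ 2 * H i + 1 + [ evenb (ℓ i) ]ᵉ
    leg-length i with ℓ i | legs≥2 i
    ... | suc m | _ = suc≡2*⌊/2⌋+1+even m

    edge-count : sumFin ℓ ≡ 2 * sumFin H + p + numEvenLegs
    edge-count = sumFin-decompose ℓ H (λ i → [ evenb (ℓ i) ]ᵉ) leg-length

    -- the second edge of the even leg
    e* : Edge
    e* = i₀ , Fin.fromℕ< (legs≥2 i₀)

    -- Apart from the edges at the center and e*, leg i consists of the edges at positions offset i, …, ℓ i − 1,
    -- a path with 2 * H i edges whose consecutive pairs share a label.
    offset : Fin p → ℕ
    offset i = suc [ evenb (ℓ i) ]ᵉ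

    leg∸offset : ∀ i → ℓ i ∸ offset i ≡ 2 * H i
    leg∸offset i = begin
      ℓ i ∸ offset i                          ≡⟨ cong (_∸ offset i) (leg-length i) ⟩
      2 * H i + 1 + [ evenb (ℓ i) ]ᵉ ∸ offset i ≡⟨ cong (_∸ offset i) (ℕ.+-assoc (2 * H i) 1 _) ⟩
      2 * H i + offset i ∸ offset i           ≡⟨ ℕ.m+n∸n≡m (2 * H i) (offset i) ⟩
      2 * H i                                 ∎
      where open ≡-Reasoning

    offset≤position : ∀ {i} {j : Fin (ℓ i)} → (i , j) ≢ e* → toℕ j ≢ 0 → offset i ≤ toℕ j
    offset≤position {i} {j} ≢e* j≢0 with evenb (ℓ i) in even
    ... | false = ℕ.n≢0⇒n>0 j≢0
    ... | true  = ℕ.≤∧≢⇒< (ℕ.n≢0⇒n>0 j≢0) λ 1≡j → ≢e* (edge-≡ i≡i₀ (trans (sym 1≡j) (sym (Fin.toℕ-fromℕ< (legs≥2 i₀)))))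
      where
      i≡i₀ : i ≡ i₀
      i≡i₀ with i Fin.≟ i₀
      ... | yes i≡i₀ = i≡i₀
      ... | no i≢i₀ with () ← trans (sym even) (odd-elsewhere i i≢i₀)

    label-bound : ∀ {i} {j : Fin (ℓ i)} → (i , j) ≢ e* → toℕ j ≢ 0 → ⌊ toℕ j ∸ offset i /2⌋ < H i
    label-bound {i} {j} ≢e* j≢0 = <⇒⌊/2⌋< (H i)
      (subst (toℕ j ∸ offset i <_) (leg∸offset i) (ℕ.∸-monoˡ-< (Fin.toℕ<n j) (offset≤position ≢e* j≢0)))

    Label : Set
    Label = Fin (suc (sumFin H))

    labelWith : ∀ i (j : Fin (ℓ i)) → (i , j) ≢ e* → Dec (toℕ j ≡ 0) → Label
    labelWith i j _   (yes _)  = zero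
    labelWith i j ≢e* (no j≢0) = suc (Inverse.to (Σ↔sumFin H) (i , Fin.fromℕ< (label-bound ≢e* j≢0)))

    same-leg-collision : ∀ {i} {j j′ : Fin (ℓ i)} → offset i ≤ toℕ j → offset i ≤ toℕ j′ →
      ⌊ toℕ j ∸ offset i /2⌋ ≡ ⌊ toℕ j′ ∸ offset i /2⌋ → (i , j) ≡ (i , j′) ⊎ ¬ VertexDisjoint (i , j) (i , j′)
    same-leg-collision {i} {j} {j′} o≤j o≤j′ same-half
      with ⌊/2⌋≡⇒≡⊎adjacent (toℕ j ∸ offset i) (toℕ j′ ∸ offset i) same-half
    ... | inj₁ eq        = inj₁ (edge-≡ refl (x∸o≡k+[y∸o]⇒x≡k+y 0 o≤j o≤j′ eq))
    ... | inj₂ (inj₁ eq) = inj₂ (consecutive-edges-meet (x∸o≡k+[y∸o]⇒x≡k+y 1 o≤j o≤j′ eq))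
    ... | inj₂ (inj₂ eq) = inj₂ (consecutive-edges-meet (x∸o≡k+[y∸o]⇒x≡k+y 1 o≤j′ o≤j eq) ∘ VertexDisjoint-sym)

    position : Σ (Fin p) (Fin ∘ H) → ℕ
    position (_ , x) = toℕ x

    labelWith-collision : ∀ {i i′} {j : Fin (ℓ i)} {j′ : Fin (ℓ i′)} ≢e* ≢e*′ d d′ →
      labelWith i j ≢e* d ≡ labelWith i′ j′ ≢e*′ d′ → (i , j) ≡ (i′ , j′) ⊎ ¬ VertexDisjoint (i , j) (i′ , j′)
    labelWith-collision _ _ (yes j≡0) (yes j′≡0) _ = inj₂ (center-edges-meet j≡0 j′≡0)
    labelWith-collision ≢e* ≢e*′ (no j≢0) (no j′≢0) eq
      with same ← Injection.injective (↔⇒↣ (Σ↔sumFin H)) (Fin.suc-injective eq)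
      with refl ← cong proj₁ same
      = same-leg-collision (offset≤position ≢e* j≢0) (offset≤position ≢e*′ j′≢0)
          (trans (sym (Fin.toℕ-fromℕ< _)) (trans (cong position same) (Fin.toℕ-fromℕ< _)))

    label : ∀ g → g ≢ e* → Label
    label (i , j) ≢e* = labelWith i j ≢e* (toℕ j ℕ.≟ 0)

    e*-matching-size≤ : ∀ {k} → MatchingIn e* k → k ≤ suc (sumFin H)
    e*-matching-size≤ M@(m , avoids , disjoint) = Fin.injective⇒≤ {f = λ a → label (m a) (avoids a)} label-injective
      where
      label-injective : ∀ {a a′} → label (m a) (avoids a) ≡ label (m a′) (avoids a′) → a ≡ a′
      label-injective {a} {a′} eq with labelWith-collision (avoids a) (avoids a′) _ _ eq
      ... | inj₁ same = matching-injective M same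
      ... | inj₂ ¬disjoint with a Fin.≟ a′
      ...   | yes a≡a′ = a≡a′
      ...   | no a≢a′  = ⊥-elim (¬disjoint (disjoint a a′ a≢a′))

    β≤1+ΣH : ∀ {β} → IsBeta β → β ≤ suc (sumFin H)
    β≤1+ΣH (β-minimal , _) with matchingNumber e*
    ... | k , ν = ℕ.≤-trans (β-minimal e* k ν) (e*-matching-size≤ (proj₁ ν))

    p+2s<edges : numEvenLegs ≡ 1 → ∀ {s} → IsBeta (suc s) → p + s * 2 < sumFin ℓ
    p+2s<edges one-even {s} isβ = begin-strict
      p + s * 2              <⟨ ℕ.n<1+n _ ⟩
      suc (p + s * 2)        ≤⟨ s≤s (ℕ.+-monoʳ-≤ p (ℕ.*-monoˡ-≤ 2 (ℕ.≤-pred (β≤1+ΣH isβ)))) ⟩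
      suc (p + sumFin H * 2) ≡⟨ rearrange p (sumFin H) ⟩
      2 * sumFin H + p + 1   ≡⟨ cong (2 * sumFin H + p +_) one-even ⟨
      2 * sumFin H + p + numEvenLegs ≡⟨ edge-count ⟨
      sumFin ℓ               ∎
      where
      open ℕ.≤-Reasoning
      rearrange : ∀ a b → suc (a + b * 2) ≡ 2 * b + a + 1
      rearrange = solve-∀

  one-even-leg⇒p+2s<edges : ∀ {p} (ℓ : Fin p → ℕ) → (∀ i → 2 ≤ ℓ i) → Spider.numEvenLegs ℓ ≡ 1 →
    ∀ {s} → Spider.IsBeta ℓ (suc s) → p + s * 2 < sumFin ℓ
  one-even-leg⇒p+2s<edges ℓ legs≥2 one-even with single-true _ one-even
  ... | i₀ , odd-elsewhere = OneEvenLeg.p+2s<edges ℓ legs≥2 i₀ odd-elsewhere one-even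

  module _ {p} (ℓ : Fin p → ℕ) (2≤p : 2 ≤ p) (legs≥2 : ∀ i → 2 ≤ ℓ i) {s} (isβ : Spider.IsBeta ℓ (suc s)) where
    open Spider ℓ

    one-even-leg : (numEvenLegs ℕ.≡ᵇ 1) ≡ true → numEvenLegs ≡ 1
    one-even-leg eq = ℕ.≡ᵇ⇒≡ numEvenLegs 1 (subst T (sym eq) _)

    no-rainbow : ∀ {n} b → (numEvenLegs ℕ.≡ᵇ 1) ≡ b → RainbowSpider ℓ (Colouring.colouring n s b) → ⊥
    no-rainbow {n} false _ copy = ℕ.<-irrefl refl (unique-light⇒β≤s unique isβ)
      where
      open RainbowCopy ℓ n s false copy
      unique : ∀ {g h} → Light g → Light h → g ≡ h
      unique lg lh = edgeColour-injective (trans (ℕ.n<1⇒n≡0 (light-colour< lg)) (sym (ℕ.n<1⇒n≡0 (light-colour< lh))))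
    no-rainbow {n} true eq copy =
      ℕ.<-irrefl refl (ℕ.<-≤-trans (one-even-leg⇒p+2s<edges ℓ legs≥2 (one-even-leg eq) isβ) (ℕ.≤-pred (ℕ.≤-pred (edges≤ 2≤p))))
      where open RainbowCopy ℓ n s true copy

    enough-vertices : ∀ {n} b → (numEvenLegs ℕ.≡ᵇ 1) ≡ b → order ≤ n → s + lightCount b < n
    enough-vertices false _  order≤n =
      ℕ.≤-trans (ℕ.≤-reflexive (cong suc (ℕ.+-comm s 1))) (ℕ.≤-trans (s≤s (matching-size≤ (proj₁ (proj₂ (proj₂ isβ))))) order≤n)
      where open SpiderProperties ℓ
    enough-vertices true  eq order≤n = ℕ.≤-trans (s≤s (ℕ.<⇒≤ (ℕ.≤-<-trans s+2≤p+2s p+2s<edges))) order≤n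
      where
      s+2≤p+2s : s + 2 ≤ p + s * 2
      s+2≤p+2s = subst (_≤ p + s * 2) (ℕ.+-comm 2 s) (ℕ.+-mono-≤ 2≤p (ℕ.m≤m*n s 2))
      p+2s<edges : p + s * 2 < sumFin ℓ
      p+2s<edges = one-even-leg⇒p+2s<edges ℓ legs≥2 (one-even-leg eq) isβ

    ar-lower-bound : ∀ n → order ≤ n → arAtLeast ℓ n ((((ℤ.+ suc s ℤ.- ℤ.+ 1) ℤ.* ℤ.+ n) ℤ.- ℤ.+ (suc s C 2)) ℤ.+ ℤ.+ r)
    ar-lower-bound n order≤n =
      Colouring.colouring n s b , Colouring.heavyCount n s + r ,
      Colouring.colouring-uses n s b s≤n (enough-vertices b refl order≤n) ,
      ℤ.≤-reflexive (colour-count n s r s≤n) ,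
      no-rainbow b refl
      where
      b : Bool
      b = numEvenLegs ℕ.≡ᵇ 1
      s≤n : s ≤ n
      s≤n = ℕ.≤-trans (ℕ.m≤m+n s (lightCount b)) (ℕ.<⇒≤ (enough-vertices b refl order≤n))

open import Defs
open import Data.Nat using (ℕ; _≤_)
open import Data.Nat using (zero; suc)
open import Data.Nat.Combinatorics using (_C_)
open import Data.Fin using (Fin)
open import Data.Fin using (zero)
open import Data.Integer using (+_; _-_; _*_; _+_)
open SpiderAntiRamsey using (module SpiderProperties; ar-lower-bound)

proposition2 : (p : ℕ) → 2 ≤ p → (ℓ : Fin p → ℕ) → (∀ i → 2 ≤ ℓ i) →
    (β : ℕ) → Spider.IsBeta ℓ β →
    (n : ℕ) → Spider.order ℓ ≤ n →
    arAtLeast ℓ n ((((+ β - + 1) * + n) - + (β C 2)) + + (Spider.r ℓ))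
proposition2 (suc p) 2≤p ℓ legs≥2 zero isβ n order≤n with () ← SpiderProperties.β-positive ℓ (legs≥2 zero) isβ
proposition2 p 2≤p ℓ legs≥2 (suc s) isβ = ar-lower-bound ℓ 2≤p legs≥2 isβ
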